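{- For every integer $n\ge 6$, the complement $\overline{W_n}$ of the wheel graph $W_n$ does not contain $K_{\lfloor 3(n-1)/4\rfloor+1}$ as a minor.
   Context: For $n\ge 4$, the wheel graph $W_n$ on $n$ vertices is the join $K_1+C_{n-1}$: a cycle on $n-1$ vertices together with one additional vertex adjacent to all vertices of the cycle. The complement $\overline{G}$ has the same vertex set as $G$, with two distinct vertices adjacent iff they are not adjacent in $G$. Minors are obtained by vertex deletions, edge deletions and edge contractions. -}

module Defs where

open import Data.Nat using (ℕ; zero; suc)
open import Data.Fin using (Fin; zero; suc; toℕ; punchIn)
open import Data.Product using (_×_; _,_; proj₁; proj₂)
open import Data.Sum using (_⊎_; inj₁; inj₂)
open import Data.Empty using (⊥)
open import Data.Unit using (⊤; tt)
open import Relation.Nullary using (¬_)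
open import Relation.Binary.PropositionalEquality using (_≡_; _≢_; refl; sym)
open import Function.Bundles using (_↔_; Inverse)

record Graph (n : ℕ) : Set₁ where
  field
    Adj    : Fin n → Fin n → Set
    adj-sym    : ∀ {a b} → Adj a b → Adj b a
    adj-irrefl : ∀ {a} → ¬ Adj a a
open Graph public

K : (t : ℕ) → Graph t
K t = record { Adj = λ a b → a ≢ b ; adj-sym = λ p q → p (sym q) ; adj-irrefl = λ p → p refl }

complement : ∀ {n} → Graph n → Graph n
complement G = record
  { Adj = λ a b → a ≢ b × ¬ Adj G a b
  ; adj-sym = λ { (p , q) → (λ e → p (sym e)) , (λ r → q (Graph.adj-sym G r)) }
  ; adj-irrefl = λ { (p , _) → p refl } }

next : (m : ℕ) → Fin m → Fin m → Set
next m i j = (suc (toℕ i) ≡ toℕ j) ⊎ (suc (toℕ i) ≡ m × toℕ j ≡ 0)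

cycAdj : (m : ℕ) → Fin m → Fin m → Set
cycAdj m i j = i ≢ j × (next m i j ⊎ next m j i)

wheelAdj : (m : ℕ) → Fin (suc m) → Fin (suc m) → Set
wheelAdj m zero    zero    = ⊥
wheelAdj m zero    (suc j) = ⊤
wheelAdj m (suc i) zero    = ⊤
wheelAdj m (suc i) (suc j) = cycAdj m i j

wheelSym : ∀ m {a b} → wheelAdj m a b → wheelAdj m b a
wheelSym m {zero}  {suc j} p = tt
wheelSym m {suc i} {zero}  p = tt
wheelSym m {suc i} {suc j} (ne , inj₁ x) = (λ e → ne (sym e)) , inj₂ x
wheelSym m {suc i} {suc j} (ne , inj₂ x) = (λ e → ne (sym e)) , inj₁ x

wheelIrr : ∀ m {a} → ¬ wheelAdj m a a
wheelIrr m {zero} ()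
wheelIrr m {suc i} (ne , _) = ne refl

-- Wheel W_n = K_1 + C_{n-1}: vertex zero is the hub, suc i (i : Fin (n-1))
-- are the cycle vertices. (This is the wheel for n ≥ 4.)
Wheel : (n : ℕ) → Graph n
Wheel zero = record { Adj = λ () ; adj-sym = λ { {()} } ; adj-irrefl = λ { {()} } }
Wheel (suc m) = record { Adj = wheelAdj m ; adj-sym = wheelSym m ; adj-irrefl = wheelIrr m }

record _≅_ {n : ℕ} (G H : Graph n) : Set where
  field
    bij      : Fin n ↔ Fin n
    preserve : ∀ a b → (Adj G a b → Adj H (Inverse.to bij a) (Inverse.to bij b))
                     × (Adj H (Inverse.to bij a) (Inverse.to bij b) → Adj G a b)

deleteVertex : ∀ {n} → Fin (suc n) → Graph (suc n) → Graph n
deleteVertex v G = record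
  { Adj = λ a b → Adj G (punchIn v a) (punchIn v b)
  ; adj-sym = Graph.adj-sym G
  ; adj-irrefl = Graph.adj-irrefl G }

deleteEdge : ∀ {n} → Fin n → Fin n → Graph n → Graph n
deleteEdge u v G = record
  { Adj = λ a b → Adj G a b × ¬ ((a ≡ u × b ≡ v) ⊎ (a ≡ v × b ≡ u))
  ; adj-sym = λ { (p , q) → Graph.adj-sym G p
                       , (λ { (inj₁ (x , y)) → q (inj₂ (y , x))
                            ; (inj₂ (x , y)) → q (inj₁ (y , x)) }) }
  ; adj-irrefl = λ { (p , _) → Graph.adj-irrefl G p } }

-- Edge contraction of the edge {punchIn v u , v}: v is merged into
-- u' = punchIn v u; the new vertex (labelled u in Fin n) is adjacent to
-- all neighbours of u' and of v (loops and multiple edges discarded).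
contractAdj : ∀ {n} → Fin (suc n) → Fin n → Graph (suc n) → Fin n → Fin n → Set
contractAdj v u G a b =
  a ≢ b × ( Adj G (punchIn v a) (punchIn v b)
          ⊎ (a ≡ u × Adj G v (punchIn v b))
          ⊎ (b ≡ u × Adj G (punchIn v a) v))

contractEdge : ∀ {n} (v : Fin (suc n)) (u : Fin n) (G : Graph (suc n)) →
               Adj G (punchIn v u) v → Graph n
contractEdge v u G _ = record
  { Adj = contractAdj v u G
  ; adj-sym = λ { (ne , inj₁ p) → (λ e → ne (sym e)) , inj₁ (Graph.adj-sym G p)
            ; (ne , inj₂ (inj₁ (e , p))) → (λ e → ne (sym e)) , inj₂ (inj₂ (e , Graph.adj-sym G p))
            ; (ne , inj₂ (inj₂ (e , p))) → (λ e → ne (sym e)) , inj₂ (inj₁ (e , Graph.adj-sym G p)) }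
  ; adj-irrefl = λ { (ne , _) → ne refl } }

data Minor {m : ℕ} (H : Graph m) : {n : ℕ} → Graph n → Set₁ where
  iso      : ∀ {G : Graph m} → G ≅ H → Minor H G
  delVert  : ∀ {n} {G : Graph (suc n)} (v : Fin (suc n)) →
             Minor H (deleteVertex v G) → Minor H G
  delEdge  : ∀ {n} {G : Graph n} (u v : Fin n) → Adj G u v →
             Minor H (deleteEdge u v G) → Minor H G
  contract : ∀ {n} {G : Graph (suc n)} (v : Fin (suc n)) (u : Fin n)
             (e : Adj G (punchIn v u) v) →
             Minor H (contractEdge v u G e) → Minor H G

{-# OPTIONS --safe #-}
module Submission where

-- A minor model of K_t in the complement of W_n cannot use the hub, which is
-- isolated there, so it lives in the complement of the rim cycle C_m (m = n − 1).
-- Let s branch sets be singletons and d have at least two vertices.  Then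
-- s + 2d ≤ m, and since any two singletons must be adjacent in the complement,
-- the singletons are pairwise non-consecutive on C_m, so 2s ≤ m.  Adding twice
-- the first inequality to the second gives 4t ≤ 3m, whereas t = ⌊3m/4⌋ + 1 has
-- 4t > 3m.  Concretely, each branch set receives four of the m × 3 slots
-- (vertex, layer), and no slot is received twice.

open import Defs
open import Data.Nat using (ℕ; zero; suc; _+_; _*_; _∸_; _≤_; _<_; s≤s; z≤n; _<?_; NonZero)
open import Data.Nat.DivMod using (_/_; _%_; m≡m%n+[m/n]*n; m%n<n; m≥n⇒m/n>0)
open import Data.Nat.Properties
  using (≤-trans; ≤-antisym; ≮⇒≥; <⇒≱; +-monoˡ-≤; +-monoˡ-<; *-monoʳ-≤; *-comm; suc-injective; 1+n≢n; module ≤-Reasoning)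
open import Data.Nat.Solver using (module +-*-Solver)
open import Data.Fin using (Fin; zero; suc; toℕ; fromℕ; fromℕ<; inject₁; punchIn; punchOut)
open import Data.Fin.Properties
  using (_≟_; any?; toℕ-fromℕ<; toℕ-injective; toℕ<n; injective⇒≤; *↔×;
         punchIn-punchOut; punchIn-injective; punchInᵢ≢i; inject₁-injective; fromℕ≢inject₁)
open import Data.Vec.Functional using (insertAt)
open import Data.Vec.Functional.Properties using (insertAt-lookup; insertAt-punchIn)
open import Data.Maybe using (Maybe; just; nothing)
open import Data.Maybe.Properties using (just-injective) renaming (≡-dec to ≡-decMaybe)
open import Data.Product using (_×_; _,_; proj₁; proj₂; ∃; ∃₂)
open import Data.Product.Function.NonDependent.Propositional using (_×-↔_)
open import Data.Sum using (_⊎_; inj₁; inj₂)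
open import Data.Empty using (⊥)
open import Data.Unit using (tt)
open import Function using (_∘_)
open import Function.Bundles using (_↔_; Inverse; Injection)
open import Function.Definitions using (Injective)
open import Function.Properties.Inverse using (↔-refl; ↔-sym; ↔-trans; ↔⇒↣)
open import Relation.Nullary using (¬_; yes; no; Dec; contradiction)
open import Relation.Nullary.Decidable using (_×-dec_; ¬?; decidable-stable)
open import Relation.Binary.PropositionalEquality
  using (_≡_; _≢_; refl; sym; trans; cong; cong₂; subst; subst₂)

-- A weakening of a minor model: the branch sets (fibres of `branch`) need only be
-- nonempty and joined along every edge of H, and no vertex may be alone inside a
-- branch set with other vertices.  Unlike connectivity of the branch sets, this
-- pulls back along a single deletion or contraction.
record Model {t n : ℕ} (H : Graph t) (G : Graph n) : Set where
  field
    branch   : Fin n → Maybe (Fin t)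
    nonempty : ∀ a → ∃ λ x → branch x ≡ just a
    edge     : ∀ {a b} → Adj H a b →
               ∃₂ λ x y → branch x ≡ just a × branch y ≡ just b × Adj G x y
    nbr      : ∀ {a x y} → x ≢ y → branch x ≡ just a → branch y ≡ just a →
               ∃ λ z → branch z ≡ just a × Adj G x z

≡-or-punchIn : ∀ {n} (v x : Fin (suc n)) → x ≡ v ⊎ ∃ λ y → punchIn v y ≡ x
≡-or-punchIn v x with v ≟ x
... | yes v≡x = inj₁ (sym v≡x)
... | no v≢x  = inj₂ (punchOut v≢x , punchIn-punchOut v≢x)

iso⇒model : ∀ {t} {H G : Graph t} → G ≅ H → Model H G
iso⇒model {H = H} G≅H = record
  { branch   = just ∘ to
  ; nonempty = λ a → from a , cong just (strictlyInverseˡ a)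
  ; edge     = λ {a} {b} ab → from a , from b
                 , cong just (strictlyInverseˡ a) , cong just (strictlyInverseˡ b)
                 , proj₂ (preserve (from a) (from b))
                     (subst₂ (Adj H) (sym (strictlyInverseˡ a)) (sym (strictlyInverseˡ b)) ab)
  ; nbr      = λ x≢y bx by →
                 contradiction (Injection.injective (↔⇒↣ bij) (just-injective (trans bx (sym by)))) x≢y
  }
  where
  open _≅_ G≅H
  open Inverse bij

deleteVertex⇒model : ∀ {t n} {H : Graph t} {G : Graph (suc n)} (v : Fin (suc n)) →
                     Model H (deleteVertex v G) → Model H G
deleteVertex⇒model {t} {n} {H} {G} v M = record
  { branch   = φ
  ; nonempty = λ a → let x , bx = nonempty a in punchIn v x , lift bx
  ; edge     = λ ab → let x , y , bx , by , xy = edge ab in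
                 punchIn v x , punchIn v y , lift bx , lift by , xy
  ; nbr      = nbr′
  }
  where
  open Model M
  φ : Fin (suc n) → Maybe (Fin t)
  φ = insertAt branch v nothing

  lift : ∀ {a x} → branch x ≡ just a → φ (punchIn v x) ≡ just a
  lift {x = x} = trans (insertAt-punchIn branch v nothing x)

  unlift : ∀ {a x} → φ (punchIn v x) ≡ just a → branch x ≡ just a
  unlift {x = x} = trans (sym (insertAt-punchIn branch v nothing x))

  φv≢just : ∀ {a} → φ v ≢ just a
  φv≢just φv with () ← trans (sym (insertAt-lookup branch v nothing)) φv

  nbr′ : ∀ {a x y} → x ≢ y → φ x ≡ just a → φ y ≡ just a → ∃ λ z → φ z ≡ just a × Adj G x z
  nbr′ {x = x} {y} x≢y φx φy with ≡-or-punchIn v x | ≡-or-punchIn v y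
  ... | inj₁ refl | _         = contradiction φx φv≢just
  ... | inj₂ _    | inj₁ refl = contradiction φy φv≢just
  ... | inj₂ (x′ , refl) | inj₂ (y′ , refl) =
    let z , bz , xz = nbr (x≢y ∘ cong (punchIn v)) (unlift φx) (unlift φy) in
    punchIn v z , lift bz , xz

deleteEdge⇒model : ∀ {t n} {H : Graph t} {G : Graph n} (u v : Fin n) →
                   Model H (deleteEdge u v G) → Model H G
deleteEdge⇒model u v M = record
  { branch   = branch
  ; nonempty = nonempty
  ; edge     = λ ab → let x , y , bx , by , xy = edge ab in x , y , bx , by , proj₁ xy
  ; nbr      = λ x≢y bx by → let z , bz , xz = nbr x≢y bx by in z , bz , proj₁ xz
  }
  where open Model M

contractEdge⇒model : ∀ {t n} {H : Graph t} {G : Graph (suc n)} (v : Fin (suc n)) (u : Fin n)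
                     (e : Adj G (punchIn v u) v) → Model H (contractEdge v u G e) → Model H G
contractEdge⇒model {t} {n} {H} {G} v u e M = record
  { branch   = φ
  ; nonempty = λ a → let x , bx = nonempty a in punchIn v x , trans (φ-punchIn x) bx
  ; edge     = edge′
  ; nbr      = nbr′
  }
  where
  open Model M
  φ : Fin (suc n) → Maybe (Fin t)
  φ = insertAt branch v (branch u)

  φ-punchIn : ∀ x → φ (punchIn v x) ≡ branch x
  φ-punchIn = insertAt-punchIn branch v (branch u)

  φ-v : φ v ≡ branch u
  φ-v = insertAt-lookup branch v (branch u)

  edge′ : ∀ {a b} → Adj H a b → ∃₂ λ x y → φ x ≡ just a × φ y ≡ just b × Adj G x y
  edge′ ab with edge ab
  ... | x , y , bx , by , _ , inj₁ xy =
    punchIn v x , punchIn v y , trans (φ-punchIn x) bx , trans (φ-punchIn y) by , xy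
  ... | x , y , bx , by , _ , inj₂ (inj₁ (refl , vy)) =
    v , punchIn v y , trans φ-v bx , trans (φ-punchIn y) by , vy
  ... | x , y , bx , by , _ , inj₂ (inj₂ (refl , xv)) =
    punchIn v x , v , trans (φ-punchIn x) bx , trans φ-v by , xv

  other-member : ∀ {a x y} → x ≢ u → punchIn v x ≢ y → φ y ≡ just a →
                 ∃ λ w → x ≢ w × branch w ≡ just a
  other-member {y = y} x≢u x≢y φy with ≡-or-punchIn v y
  ... | inj₁ refl        = u , x≢u , trans (sym φ-v) φy
  ... | inj₂ (y′ , refl) = y′ , x≢y ∘ cong (punchIn v) , trans (sym (φ-punchIn y′)) φy

  nbr-uncontracted : ∀ {a x w} → x ≢ u → x ≢ w → branch x ≡ just a → branch w ≡ just a →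
                     ∃ λ z → φ z ≡ just a × Adj G (punchIn v x) z
  nbr-uncontracted x≢u x≢w bx bw with nbr x≢w bx bw
  ... | z , bz , _ , inj₁ xz                 = punchIn v z , trans (φ-punchIn z) bz , xz
  ... | _ , _  , _ , inj₂ (inj₁ (x≡u , _))   = contradiction x≡u x≢u
  ... | _ , bz , _ , inj₂ (inj₂ (refl , xv)) = v , trans φ-v bz , xv

  nbr′ : ∀ {a x y} → x ≢ y → φ x ≡ just a → φ y ≡ just a → ∃ λ z → φ z ≡ just a × Adj G x z
  nbr′ {x = x} x≢y φx φy with ≡-or-punchIn v x
  ... | inj₁ refl = punchIn v u , trans (φ-punchIn u) (trans (sym φ-v) φx) , adj-sym G e
  ... | inj₂ (x′ , refl) with x′ ≟ u
  ...   | yes refl = v , trans φ-v (trans (sym (φ-punchIn u)) φx) , e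
  ...   | no x′≢u  =
    let w , x′≢w , bw = other-member x′≢u x≢y φy in
    nbr-uncontracted x′≢u x′≢w (trans (sym (φ-punchIn x′)) φx) bw

minor⇒model : ∀ {t n} {H : Graph t} {G : Graph n} → Minor H G → Model H G
minor⇒model (iso G≅H)          = iso⇒model G≅H
minor⇒model (delVert v m)      = deleteVertex⇒model v (minor⇒model m)
minor⇒model (delEdge u v _ m)  = deleteEdge⇒model u v (minor⇒model m)
minor⇒model (contract v u e m) = contractEdge⇒model v u e (minor⇒model m)

module _ {t n} {H : Graph t} {G : Graph n} (M : Model H G) (H-nbr : ∀ a → ∃ (Adj H a)) where
  open Model M

  branched⇒nonisolated : ∀ {a x} → branch x ≡ just a → ∃ (Adj G x)
  branched⇒nonisolated {a} {x} bx with H-nbr a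
  ... | _ , ab with edge ab
  ...   | x′ , y , bx′ , _ , x′y with x ≟ x′
  ...     | yes refl = y , x′y
  ...     | no x≢x′  = let z , _ , xz = nbr x≢x′ bx bx′ in z , xz

  isolated-unbranched : ∀ {x} → (∀ y → ¬ Adj G x y) → branch x ≡ nothing
  isolated-unbranched {x} x-isolated with branch x in bx
  ... | nothing = refl
  ... | just _  = let y , xy = branched⇒nonisolated bx in contradiction xy (x-isolated y)

deleteUnbranched : ∀ {t n} {H : Graph t} {G : Graph (suc n)} (M : Model H G) {v} →
                   Model.branch M v ≡ nothing → Model H (deleteVertex v G)
deleteUnbranched {H = H} {G} M {v} bv = record
  { branch   = branch ∘ punchIn v
  ; nonempty = nonempty′
  ; edge     = edge′
  ; nbr      = nbr′
  }
  where
  open Model M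
  inside : ∀ {a x} → branch x ≡ just a → ∃ λ x′ → punchIn v x′ ≡ x
  inside {x = x} bx with ≡-or-punchIn v x
  ... | inj₁ refl = contradiction (trans (sym bv) bx) λ ()
  ... | inj₂ p    = p

  nonempty′ : ∀ a → ∃ λ x → branch (punchIn v x) ≡ just a
  nonempty′ a with nonempty a
  ... | x , bx with inside bx
  ...   | x′ , refl = x′ , bx

  edge′ : ∀ {a b} → Adj H a b → ∃₂ λ x y → branch (punchIn v x) ≡ just a ×
          branch (punchIn v y) ≡ just b × Adj G (punchIn v x) (punchIn v y)
  edge′ ab with edge ab
  ... | x , y , bx , by , xy with inside bx | inside by
  ...   | x′ , refl | y′ , refl = x′ , y′ , bx , by , xy

  nbr′ : ∀ {a x y} → x ≢ y → branch (punchIn v x) ≡ just a → branch (punchIn v y) ≡ just a →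
         ∃ λ z → branch (punchIn v z) ≡ just a × Adj G (punchIn v x) (punchIn v z)
  nbr′ x≢y bx by with nbr (x≢y ∘ punchIn-injective v _ _) bx by
  ... | z , bz , xz with inside bz
  ...   | z′ , refl = z′ , bz , xz

K-nonisolated : ∀ {t} → 1 < t → (a : Fin t) → ∃ (Adj (K t) a)
K-nonisolated (s≤s (s≤s _)) a = punchIn a zero , punchInᵢ≢i a zero ∘ sym

sucMod : ∀ {m} → Fin m → Fin m
sucMod {suc m} i with suc (toℕ i) <? suc m
... | yes 1+i<m = fromℕ< 1+i<m
... | no _      = zero

next-sucMod : ∀ {m} (i : Fin m) → next m i (sucMod i)
next-sucMod {suc m} i with suc (toℕ i) <? suc m
... | yes 1+i<m = inj₁ (sym (toℕ-fromℕ< 1+i<m))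
... | no 1+i≮m  = inj₂ (≤-antisym (toℕ<n i) (≮⇒≥ 1+i≮m) , refl)

next-injectiveˡ : ∀ {m} {i i′ j : Fin m} → next m i j → next m i′ j → i ≡ i′
next-injectiveˡ (inj₁ e) (inj₁ e′)           = toℕ-injective (suc-injective (trans e (sym e′)))
next-injectiveˡ (inj₁ e) (inj₂ (_ , e′))     with () ← trans e e′
next-injectiveˡ (inj₂ (_ , e′)) (inj₁ e)     with () ← trans e e′
next-injectiveˡ (inj₂ (e , _)) (inj₂ (e′ , _)) = toℕ-injective (suc-injective (trans e (sym e′)))

next-irrefl : ∀ {m} → 1 < m → {i : Fin m} → ¬ next m i i
next-irrefl _ (inj₁ e) = 1+n≢n e
next-irrefl (s≤s (s≤s _)) (inj₂ (e , i≡0)) with () ← trans (sym e) (cong suc i≡0)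

↔-injective⇒≤ : ∀ {A B : Set} {m n} (I : Fin m ↔ A) (J : Fin n ↔ B) {f : A → B} →
                Injective _≡_ _≡_ f → m ≤ n
↔-injective⇒≤ I J {f} f-inj = injective⇒≤ {f = Inverse.from J ∘ f ∘ Inverse.to I}
  (Injection.injective (↔⇒↣ I) ∘ f-inj ∘ Injection.injective (↔⇒↣ (↔-sym J)))

module CycleComplementModel {m t : ℕ} (1<m : 1 < m) (G : Graph m)
  (G⊆C̄ : ∀ {i j} → Adj G i j → ¬ cycAdj m i j) (M : Model (K t) G) where
  open Model M

  rep : Fin t → Fin m
  rep a = proj₁ (nonempty a)

  branch-rep : ∀ a → branch (rep a) ≡ just a
  branch-rep a = proj₂ (nonempty a)

  rep-injective : ∀ {a b} → rep a ≡ rep b → a ≡ b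
  rep-injective {a} {b} eq = just-injective (trans (sym (branch-rep a)) (trans (cong branch eq) (branch-rep b)))

  Shared : Fin t → Set
  Shared a = ∃ λ j → j ≢ rep a × branch j ≡ just a

  shared? : ∀ a → Dec (Shared a)
  shared? a = any? λ j → ¬? (j ≟ rep a) ×-dec ≡-decMaybe _≟_ (branch j) (just a)

  unshared⇒rep : ∀ {a j} → ¬ Shared a → branch j ≡ just a → j ≡ rep a
  unshared⇒rep {a} {j} ¬sh bj = decidable-stable (j ≟ rep a) λ j≢rep → ¬sh (j , j≢rep , bj)

  unshared-apart : ∀ {a b} → a ≢ b → ¬ Shared a → ¬ Shared b → ¬ cycAdj m (rep a) (rep b)
  unshared-apart a≢b ¬sa ¬sb with edge a≢b
  ... | x , y , bx , by , xy with unshared⇒rep ¬sa bx | unshared⇒rep ¬sb by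
  ...   | refl | refl = G⊆C̄ xy

  partner : ∀ a → Dec (Shared a) → Fin m
  partner a (yes (j , _)) = j
  partner a (no _)        = sucMod (rep a)

  partner≢rep : ∀ a d → partner a d ≢ rep a
  partner≢rep a (yes (_ , j≢rep , _)) = j≢rep
  partner≢rep a (no _) eq = next-irrefl 1<m (subst (next m (rep a)) eq (next-sucMod (rep a)))

  vertex : ∀ a → Dec (Shared a) → Fin 2 → Fin m
  vertex a d zero       = rep a
  vertex a d (suc zero) = partner a d

  vertex-injective : ∀ a d → Injective _≡_ _≡_ (vertex a d)
  vertex-injective a d {zero}     {zero}     _  = refl
  vertex-injective a d {zero}     {suc zero} eq = contradiction (sym eq) (partner≢rep a d)
  vertex-injective a d {suc zero} {zero}     eq = contradiction eq (partner≢rep a d)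
  vertex-injective a d {suc zero} {suc zero} _  = refl

  Slot : Set
  Slot = Fin m × Fin 3

  top : Fin 3
  top = fromℕ 2

  -- A shared branch set takes its two vertices in the lower two layers; a
  -- singleton {x} takes x in the lower two layers and x and its cycle successor
  -- in the top layer.
  slot : ∀ a → Dec (Shared a) → Fin 2 × Fin 2 → Slot
  slot a d@(yes _) (u , l)        = vertex a d u , inject₁ l
  slot a (no _)    (u , zero)     = rep a , inject₁ u
  slot a d@(no _)  (u , suc zero) = vertex a d u , top

  Owns : Fin t → Slot → Set
  Owns a (x , l) = (l ≢ top × branch x ≡ just a)
                 ⊎ (¬ Shared a × l ≡ top × (x ≡ rep a ⊎ next m (rep a) x))

  owns-slot : ∀ a d p → Owns a (slot a d p)
  owns-slot a (yes _)            (zero , _)            = inj₁ (fromℕ≢inject₁ ∘ sym , branch-rep a)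
  owns-slot a (yes (_ , _ , bj)) (suc zero , _)        = inj₁ (fromℕ≢inject₁ ∘ sym , bj)
  owns-slot a (no _)             (_ , zero)            = inj₁ (fromℕ≢inject₁ ∘ sym , branch-rep a)
  owns-slot a (no ¬sh)           (zero , suc zero)     = inj₂ (¬sh , refl , inj₁ refl)
  owns-slot a (no ¬sh)           (suc zero , suc zero) = inj₂ (¬sh , refl , inj₂ (next-sucMod (rep a)))

  top-owner-unique : ∀ {a b x} → ¬ Shared a → ¬ Shared b →
                     x ≡ rep a ⊎ next m (rep a) x → x ≡ rep b ⊎ next m (rep b) x → a ≡ b
  top-owner-unique {a} {b} {x} ¬sa ¬sb xa xb = decidable-stable (a ≟ b) λ a≢b → clash a≢b xa xb
    where
    clash : a ≢ b → x ≡ rep a ⊎ next m (rep a) x → x ≡ rep b ⊎ next m (rep b) x → ⊥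
    clash a≢b (inj₁ refl) (inj₁ x≡rb) = a≢b (rep-injective x≡rb)
    clash a≢b (inj₁ refl) (inj₂ nx)   = unshared-apart a≢b ¬sa ¬sb (a≢b ∘ rep-injective , inj₂ nx)
    clash a≢b (inj₂ nx)   (inj₁ refl) = unshared-apart a≢b ¬sa ¬sb (a≢b ∘ rep-injective , inj₁ nx)
    clash a≢b (inj₂ na)   (inj₂ nb)   = a≢b (rep-injective (next-injectiveˡ na nb))

  owner-unique : ∀ {a b} s → Owns a s → Owns b s → a ≡ b
  owner-unique _ (inj₁ (_ , ba))         (inj₁ (_ , bb))         = just-injective (trans (sym ba) bb)
  owner-unique _ (inj₁ (l≢top , _))      (inj₂ (_ , l≡top , _))  = contradiction l≡top l≢top
  owner-unique _ (inj₂ (_ , l≡top , _))  (inj₁ (l≢top , _))      = contradiction l≡top l≢top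
  owner-unique _ (inj₂ (¬sa , _ , xa))   (inj₂ (¬sb , _ , xb))   = top-owner-unique ¬sa ¬sb xa xb

  slot-injective : ∀ a d → Injective _≡_ _≡_ (slot a d)
  slot-injective a d@(yes _) eq =
    cong₂ _,_ (vertex-injective a d (cong proj₁ eq)) (inject₁-injective (cong proj₂ eq))
  slot-injective a (no _) {_ , zero} {_ , zero} eq =
    cong (_, zero) (inject₁-injective (cong proj₂ eq))
  slot-injective a (no _) {_ , zero} {_ , suc zero} eq = contradiction (sym (cong proj₂ eq)) fromℕ≢inject₁
  slot-injective a (no _) {_ , suc zero} {_ , zero} eq = contradiction (cong proj₂ eq) fromℕ≢inject₁
  slot-injective a d@(no _) {_ , suc zero} {_ , suc zero} eq =
    cong (_, suc zero) (vertex-injective a d (cong proj₁ eq))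

  assign : Fin t × (Fin 2 × Fin 2) → Slot
  assign (a , p) = slot a (shared? a) p

  assign-injective : Injective _≡_ _≡_ assign
  assign-injective {a , p} {b , q} eq
    with owner-unique (assign (b , q)) (subst (Owns a) eq (owns-slot a (shared? a) p)) (owns-slot b (shared? b) q)
  ... | refl = cong (a ,_) (slot-injective a (shared? a) eq)

  4t≤3m : 4 * t ≤ 3 * m
  4t≤3m = subst₂ _≤_ (*-comm t 4) (*-comm m 3)
    (↔-injective⇒≤ (↔-trans (*↔× {t} {4}) (↔-refl ×-↔ *↔× {2} {2})) (*↔× {m} {3}) assign-injective)

complement-wheel-hub-isolated : ∀ {m} y → ¬ Adj (complement (Wheel (suc m))) zero y
complement-wheel-hub-isolated zero    (0≢0 , _) = 0≢0 refl
complement-wheel-hub-isolated (suc y) (_ , ¬adj) = ¬adj tt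

K-model-in-complement-wheel⇒4t≤3m : ∀ {m t} → 1 < m → 1 < t →
                                     Model (K t) (complement (Wheel (suc m))) → 4 * t ≤ 3 * m
K-model-in-complement-wheel⇒4t≤3m {m} 1<m 1<t M =
  CycleComplementModel.4t≤3m 1<m (deleteVertex zero (complement (Wheel (suc m)))) proj₂
    (deleteUnbranched M (isolated-unbranched M (K-nonisolated 1<t) complement-wheel-hub-isolated))

m<n*[m/n+1] : ∀ m n .{{_ : NonZero n}} → m < n * (m / n + 1)
m<n*[m/n+1] m n = begin-strict
  m                   ≡⟨ m≡m%n+[m/n]*n m n ⟩
  m % n + m / n * n   <⟨ +-monoˡ-< (m / n * n) (m%n<n m n) ⟩
  n + m / n * n       ≡⟨ solve 2 (λ n q → n :+ q :* n := n :* (q :+ con 1)) refl n (m / n) ⟩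
  n * (m / n + 1)     ∎
  where
  open ≤-Reasoning
  open +-*-Solver

theorem5 : (n : ℕ) → 6 ≤ n → ¬ Minor (K ((3 * (n ∸ 1)) / 4 + 1)) (complement (Wheel n))
theorem5 (suc m) (s≤s 5≤m) minor =
  <⇒≱ (m<n*[m/n+1] (3 * m) 4) (K-model-in-complement-wheel⇒4t≤3m 1<m 1<t (minor⇒model minor))
  where
  1<m : 1 < m
  1<m = ≤-trans (s≤s (s≤s z≤n)) 5≤m
  1<t : 1 < 3 * m / 4 + 1
  1<t = +-monoˡ-≤ 1 (m≥n⇒m/n>0 (≤-trans (s≤s (s≤s (s≤s (s≤s z≤n)))) (*-monoʳ-≤ 3 5≤m)))
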